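{- Let $r\geq 1$ and $T=\mathrm{Th}(\mathrm{Sh}_r(\omega))$. Every model $M$ of $T$, say of cardinality $\lambda$, can be embedded as an induced subgraph of $\mathrm{Sh}_r^{sym}(A)$ for some infinite set $A$ of cardinality $\lambda$.
   Context: For a linearly ordered set $(A,<)$ and $r\geq1$, the shift graph $\mathrm{Sh}_r(A)$ has as vertices the strictly increasing $r$-tuples $(s_0<\dots<s_{r-1})$ from $A$, with $s,t$ adjacent iff $s\neq t$ and either $s_i=t_{i-1}$ for all $1\leq i\leq r-1$, or $t_i=s_{i-1}$ for all $1\leq i\leq r-1$ (for $r=1$ this is the complete graph on $A$). The symmetric shift graph $\mathrm{Sh}_r^{sym}(A)$ (for any set $A$) is defined in the same way but with vertex set all $r$-tuples of pairwise distinct elements of $A$. An embedding as an induced subgraph is an injective map $f$ with $x\mathrel{E}y\iff f(x)\mathrel{E}f(y)$. -}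

module Defs where

open import Level using (Level; 0ℓ)
open import Data.Nat using (ℕ; zero; suc; _<_)
open import Data.Fin using (Fin; toℕ)
open import Data.Vec using (Vec; []; _∷_; lookup)
open import Data.Vec.Relation.Unary.Linked using (Linked)
open import Data.Vec.Relation.Unary.AllPairs using (AllPairs)
open import Data.Product using (Σ; _×_; proj₁)
open import Data.Sum using (_⊎_)
open import Data.Empty.Polymorphic using (⊥)
open import Relation.Binary.PropositionalEquality using (_≡_; _≢_)
open import Relation.Nullary using (¬_)
open import Function.Bundles using (_↔_)

record Graph (ℓ : Level) : Set (Level.suc ℓ) where
  field
    Carrier : Set ℓ
    Adj     : Carrier → Carrier → Set ℓ

open Graph public

data Formula : ℕ → Set where
  adj  : ∀ {n} → Fin n → Fin n → Formula n
  eq   : ∀ {n} → Fin n → Fin n → Formula n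
  falsum : ∀ {n} → Formula n
  _⇒_  : ∀ {n} → Formula n → Formula n → Formula n
  _∧_  : ∀ {n} → Formula n → Formula n → Formula n
  _∨_  : ∀ {n} → Formula n → Formula n → Formula n
  all  : ∀ {n} → Formula (suc n) → Formula n
  ex   : ∀ {n} → Formula (suc n) → Formula n

Sentence : Set
Sentence = Formula zero

-- Tarskian satisfaction (classical when ExcludedMiddle is assumed).
Sat : ∀ {ℓ n} (G : Graph ℓ) → Vec (Carrier G) n → Formula n → Set ℓ
Sat G ρ (adj i j) = Adj G (lookup ρ i) (lookup ρ j)
Sat G ρ (eq i j)  = lookup ρ i ≡ lookup ρ j
Sat G ρ falsum    = ⊥
Sat G ρ (φ ⇒ ψ)   = Sat G ρ φ → Sat G ρ ψ
Sat G ρ (φ ∧ ψ)   = Sat G ρ φ × Sat G ρ ψ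
Sat G ρ (φ ∨ ψ)   = Sat G ρ φ ⊎ Sat G ρ ψ
Sat G ρ (all φ)   = (a : Carrier G) → Sat G (a ∷ ρ) φ
Sat G ρ (ex φ)    = Σ (Carrier G) λ a → Sat G (a ∷ ρ) φ

_⊨_ : ∀ {ℓ} → Graph ℓ → Sentence → Set ℓ
G ⊨ φ = Sat G [] φ

ModelOfTh : ∀ {ℓ ℓ'} → Graph ℓ → Graph ℓ' → Set (ℓ Level.⊔ ℓ')
ModelOfTh G M = (φ : Sentence) → G ⊨ φ → M ⊨ φ

ShiftsTo : ∀ {a} {A : Set a} {r} → Vec A r → Vec A r → Set a
ShiftsTo {r = r} s t = (i j : Fin r) → toℕ i ≡ suc (toℕ j) → lookup s i ≡ lookup t j

ShiftAdj : ∀ {a} {A : Set a} {r} → Vec A r → Vec A r → Set a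
ShiftAdj s t = s ≢ t × (ShiftsTo s t ⊎ ShiftsTo t s)

Sh : ℕ → Graph 0ℓ
Carrier (Sh r) = Σ (Vec ℕ r) (Linked _<_)
Adj     (Sh r) s t = ShiftAdj (proj₁ s) (proj₁ t)

DistinctTuple : ∀ {a} (A : Set a) → (r : ℕ) → Vec A r → Set a
DistinctTuple A r v = AllPairs _≢_ v

record EmbedsInSymShift {ℓ} (r : ℕ) (M : Graph ℓ) (A : Set ℓ) : Set ℓ where
  field
    f         : Carrier M → Vec A r
    distinct  : (x : Carrier M) → DistinctTuple A r (f x)
    injective : (x y : Carrier M) → f x ≡ f y → x ≡ y
    preserve  : (x y : Carrier M) → Adj M x y → ShiftAdj (f x) (f y)
    reflect   : (x y : Carrier M) → ShiftAdj (f x) (f y) → Adj M x y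

Infinite : ∀ {ℓ} → Set ℓ → Set ℓ
Infinite A = (n : ℕ) → ¬ (A ↔ Fin n)

-- Write R = r ≥ 1.  For a suitable injective code : ℕ → Sh_R(ω), the map
-- x ↦ (code x₀, …, code x_{R-1}) is tautologically an induced embedding of Sh_R(ω) into
-- Sh_R^sym of its own vertex set.  Each x ↦ code xₖ is first-order definable: for R ≥ 2 the
-- direction of an edge can be read off common neighbourhoods (the vertices with x₀ = 0 are
-- those without predecessors), hence so are k-fold shifts, the minimum x₀ of a vertex (as the
-- length of a chain of predecessors) and finally code xₖ.  The sentences saying that these
-- definable functions are total, take distinct values, separate points and turn adjacency into
-- the shift relation hold in Sh_R(ω), so in every model M, where they define an embedding of M
-- into Sh_R^sym(M).  Sentences "there are k distinct vertices" make M infinite.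

{-# OPTIONS --safe #-}
module Submission where

open import Defs
open import Level using (Level; lift; lower)
open import Data.Nat as ℕ using (ℕ; zero; suc; _+_; _∸_; _≤_; _<_; z≤n; s≤s; z<s; s<s; _≤?_)
open import Data.Nat.Properties hiding (_≟_)
open import Data.Fin using (Fin; zero; suc; toℕ; fromℕ<; _≟_)
import Data.Fin.Properties as Fin
open import Data.Fin.Properties using (injective⇒≤; toℕ-fromℕ<; toℕ<n)
open import Data.Vec using (Vec; []; _∷_; lookup; tabulate; map)
open import Data.Vec.Properties
  using (lookup∘tabulate; tabulate-cong; tabulate∘lookup; tabulate-∘; lookup-map; ∷-injectiveˡ; ∷-injectiveʳ)
open import Data.Vec.Relation.Unary.AllPairs.Properties using (tabulate⁺)
import Data.Vec.Relation.Unary.Linked as Linked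
open Linked using (Linked; []; [-]; _∷_)
open import Data.Vec.Relation.Unary.Linked.Properties using (lookup⁺)
open import Relation.Binary.Definitions using (tri<; tri≈; tri>)
open import Data.Product using (Σ; ∃; _×_; _,_; proj₁; proj₂)
open import Data.Product.Function.NonDependent.Propositional using (_×-⇔_)
open import Data.Product.Function.Dependent.Propositional using (Σ-⇔)
open import Function.Construct.Identity using (↠-id)
open import Data.Sum using (_⊎_; inj₁; inj₂; swap; map₂)
open import Data.Sum.Function.Propositional using (_⊎-⇔_)
open import Data.Empty using (⊥-elim)
open import Relation.Binary.PropositionalEquality
open import Relation.Nullary using (¬_; Dec; yes; no; ¬?)
open import Function using (_∘_; case_of_)
open import Function.Bundles using (_⇔_; mk⇔; Equivalence; _↔_; Injection)
open import Function.Properties.Inverse using (↔⇒↣; ↔-refl)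
open import Function.Definitions using (Injective)
open import Function.Related.TypeIsomorphisms using (→-cong-⇔; ¬-cong-⇔)
open import Function.Related.Propositional using (module EquationalReasoning; equivalence)
import Function.Properties.Equivalence as ⇔
open Equivalence using (to; from)
open import Axiom.ExcludedMiddle using (ExcludedMiddle)

private
  variable
    ℓ : Level
    i j k m r : ℕ

∀-⇔ : ∀ {a b c} {I : Set a} {A : I → Set b} {B : I → Set c} →
      (∀ i → A i ⇔ B i) → (∀ i → A i) ⇔ (∀ i → B i)
∀-⇔ e = mk⇔ (λ f i → to (e i) (f i)) (λ f i → from (e i) (f i))

⇔-cong : ∀ {a b c d} {A : Set a} {A′ : Set b} {B : Set c} {B′ : Set d} →
         A ⇔ A′ → B ⇔ B′ → (A ⇔ B) ⇔ (A′ ⇔ B′)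
⇔-cong eA eB = mk⇔ (λ e → ⇔.trans (⇔.sym eA) (⇔.trans e eB)) (λ e → ⇔.trans eA (⇔.trans e (⇔.sym eB)))

tabulate-≡⇔ : ∀ {a} {A : Set a} {f g : Fin k → A} → (∀ i → f i ≡ g i) ⇔ (tabulate f ≡ tabulate g)
tabulate-≡⇔ {f = f} {g} = mk⇔ tabulate-cong λ e i →
  trans (sym (lookup∘tabulate f i)) (trans (cong (λ v → lookup v i) e) (lookup∘tabulate g i))

v0 : Fin (suc m)
v0 = zero

v1 : Fin (suc (suc m))
v1 = suc zero

v2 : Fin (suc (suc (suc m)))
v2 = suc (suc zero)

infix 30 _⟨_,_⟩
infix 25 ¬ᶠ_
infixr 22 _⊃_
infix 15 _⇔ᶠ_

⊤ᶠ : Formula m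
⊤ᶠ = falsum ⇒ falsum

¬ᶠ_ : Formula m → Formula m
¬ᶠ φ = φ ⇒ falsum

_⇔ᶠ_ : Formula m → Formula m → Formula m
φ ⇔ᶠ ψ = (φ ⇒ ψ) ∧ (ψ ⇒ φ)

⋀ : (Fin k → Formula m) → Formula m
⋀ {zero}  φ = ⊤ᶠ
⋀ {suc k} φ = φ zero ∧ ⋀ (φ ∘ suc)

⋁ : (Fin k → Formula m) → Formula m
⋁ {zero}  φ = falsum
⋁ {suc k} φ = φ zero ∨ ⋁ (φ ∘ suc)

_⊃_ : ∀ {p} {P : Set p} → Dec P → Formula m → Formula m
yes _ ⊃ φ = φ
no _  ⊃ φ = ⊤ᶠ

liftᵛ : ∀ {n} → (Fin m → Fin n) → Fin (suc m) → Fin (suc n)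
liftᵛ σ zero    = zero
liftᵛ σ (suc i) = suc (σ i)

rename : ∀ {n} → (Fin m → Fin n) → Formula m → Formula n
rename σ (adj i j) = adj (σ i) (σ j)
rename σ (eq i j)  = eq (σ i) (σ j)
rename σ falsum    = falsum
rename σ (φ ⇒ ψ)   = rename σ φ ⇒ rename σ ψ
rename σ (φ ∧ ψ)   = rename σ φ ∧ rename σ ψ
rename σ (φ ∨ ψ)   = rename σ φ ∨ rename σ ψ
rename σ (all φ)   = all (rename (liftᵛ σ) φ)
rename σ (ex φ)    = ex (rename (liftᵛ σ) φ)

_⟨_,_⟩ : Formula 2 → Fin m → Fin m → Formula m
ψ ⟨ a , b ⟩ = rename (λ { zero → b ; (suc _) → a }) ψ

module _ (G : Graph ℓ) where

  private
    C = Carrier G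

  -- A binary formula ψ(x, y) has y as variable 0 and x as variable 1, the order in which
  -- all (ex ψ) binds them.
  Holds : Formula 2 → C → C → Set ℓ
  Holds ψ x y = Sat G (y ∷ x ∷ []) ψ

  private
    extend-env : ∀ {n} {σ : Fin m → Fin n} {ρ : Vec C m} {ρ′ : Vec C n} a →
                 (∀ i → lookup ρ′ (σ i) ≡ lookup ρ i) →
                 ∀ i → lookup (a ∷ ρ′) (liftᵛ σ i) ≡ lookup (a ∷ ρ) i
    extend-env a h zero    = refl
    extend-env a h (suc i) = h i

  Sat-rename : ∀ {n} (σ : Fin m → Fin n) {ρ : Vec C m} {ρ′ : Vec C n} →
               (∀ i → lookup ρ′ (σ i) ≡ lookup ρ i) →
               ∀ φ → Sat G ρ′ (rename σ φ) ⇔ Sat G ρ φ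
  Sat-rename σ h (adj i j) = mk⇔ (subst₂ (Adj G) (h i) (h j)) (subst₂ (Adj G) (sym (h i)) (sym (h j)))
  Sat-rename σ h (eq i j)  = mk⇔ (subst₂ _≡_ (h i) (h j)) (subst₂ _≡_ (sym (h i)) (sym (h j)))
  Sat-rename σ h falsum    = ⇔.refl
  Sat-rename σ h (φ ⇒ ψ)   = →-cong-⇔ (Sat-rename σ h φ) (Sat-rename σ h ψ)
  Sat-rename σ h (φ ∧ ψ)   = Sat-rename σ h φ ×-⇔ Sat-rename σ h ψ
  Sat-rename σ h (φ ∨ ψ)   = Sat-rename σ h φ ⊎-⇔ Sat-rename σ h ψ
  Sat-rename σ h (all φ)   = ∀-⇔ λ a → Sat-rename (liftᵛ σ) (extend-env a h) φ
  Sat-rename σ h (ex φ)    = Σ-⇔ (↠-id _) (Sat-rename (liftᵛ σ) (extend-env _ h) φ)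

  Sat-⟨,⟩ : ∀ (ψ : Formula 2) {ρ : Vec C m} a b →
            Sat G ρ (ψ ⟨ a , b ⟩) ⇔ Holds ψ (lookup ρ a) (lookup ρ b)
  Sat-⟨,⟩ ψ a b = Sat-rename _ (λ { zero → refl ; (suc zero) → refl }) ψ

  module _ {ρ : Vec C m} where

    Sat-¬ᶠ : ∀ φ → Sat G ρ (¬ᶠ φ) ⇔ (¬ Sat G ρ φ)
    Sat-¬ᶠ φ = mk⇔ (λ f → lower ∘ f) (λ f → lift ∘ f)

    Sat-⇔ᶠ : ∀ φ ψ → Sat G ρ (φ ⇔ᶠ ψ) ⇔ (Sat G ρ φ ⇔ Sat G ρ ψ)
    Sat-⇔ᶠ φ ψ = mk⇔ (λ (f , g) → mk⇔ f g) (λ e → to e , from e)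

    Sat-⋀ : (φ : Fin k → Formula m) → Sat G ρ (⋀ φ) ⇔ (∀ i → Sat G ρ (φ i))
    Sat-⋀ {zero}  φ = mk⇔ (λ _ ()) (λ _ x → x)
    Sat-⋀ {suc k} φ = mk⇔ (λ { (s , ss) zero → s ; (s , ss) (suc i) → to (Sat-⋀ (φ ∘ suc)) ss i })
                          (λ f → f zero , from (Sat-⋀ (φ ∘ suc)) (f ∘ suc))

    Sat-⋁ : (φ : Fin k → Formula m) → Sat G ρ (⋁ φ) ⇔ (∃ λ i → Sat G ρ (φ i))
    Sat-⋁ {zero}  φ = mk⇔ (λ ()) (λ ())
    Sat-⋁ {suc k} φ = mk⇔
      (λ { (inj₁ s) → zero , s ; (inj₂ s) → let (i , s′) = to (Sat-⋁ (φ ∘ suc)) s in suc i , s′ })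
      (λ { (zero , s) → inj₁ s ; (suc i , s) → inj₂ (from (Sat-⋁ (φ ∘ suc)) (i , s)) })

    Sat-⊃ : ∀ {p} {P : Set p} (d : Dec P) φ → Sat G ρ (d ⊃ φ) ⇔ (P → Sat G ρ φ)
    Sat-⊃ (yes p) φ = mk⇔ (λ s _ → s) (λ f → f p)
    Sat-⊃ (no ¬p) φ = mk⇔ (λ _ p → ⊥-elim (¬p p)) (λ _ x → x)

-- Definable coordinates and the embedding they induce

IsFunction : Formula 2 → Sentence
IsFunction ψ = all (ex (ψ ∧ all (ψ ⟨ v2 , v0 ⟩ ⇒ eq v0 v1)))

module _ (G : Graph ℓ) where

  private
    C = Carrier G

  Defines : Formula 2 → (C → C) → Set ℓ
  Defines ψ F = ∀ x y → Holds G ψ x y ⇔ (y ≡ F x)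

  defines⇒⊨IsFunction : ∀ ψ {F} → Defines ψ F → G ⊨ IsFunction ψ
  defines⇒⊨IsFunction ψ {F} d x =
    F x , from (d x (F x)) refl , λ y h → to (d x y) (to (Sat-⟨,⟩ G ψ v2 v0) h)

  ⊨IsFunction⇒defines : ∀ ψ → G ⊨ IsFunction ψ → Σ (C → C) (Defines ψ)
  ⊨IsFunction⇒defines ψ fun = F , λ x y →
    mk⇔ (λ h → proj₂ (proj₂ (fun x)) y (from (Sat-⟨,⟩ G ψ v2 v0) h))
        (λ { refl → proj₁ (proj₂ (fun x)) })
    where
    F : C → C
    F x = proj₁ (fun x)

module _ {R : ℕ} (φ : Fin R → Formula 2) where

  CoordEq : Fin R → Fin R → Fin m → Fin m → Formula m
  CoordEq i j a b = ex (φ i ⟨ suc a , v0 ⟩ ∧ φ j ⟨ suc b , v0 ⟩)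

  SameCoords : Fin m → Fin m → Formula m
  SameCoords a b = ⋀ λ k → CoordEq k k a b

  ShiftedCoords : Fin m → Fin m → Formula m
  ShiftedCoords a b = ⋀ λ i → ⋀ λ j → (toℕ i ℕ.≟ suc (toℕ j)) ⊃ CoordEq i j a b

  CoordsDistinct : Sentence
  CoordsDistinct = all (⋀ λ i → ⋀ λ j → ¬? (i ≟ j) ⊃ ¬ᶠ CoordEq i j v0 v0)

  CoordsDetermine : Sentence
  CoordsDetermine = all (all (SameCoords v1 v0 ⇒ eq v1 v0))

  AdjacencyIsShift : Sentence
  AdjacencyIsShift =
    all (all (adj v1 v0 ⇔ᶠ (¬ᶠ SameCoords v1 v0 ∧ (ShiftedCoords v1 v0 ∨ ShiftedCoords v0 v1))))

module Coordinates (G : Graph ℓ) {R : ℕ} {φ : Fin R → Formula 2}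
                   {π : Fin R → Carrier G → Carrier G} (φ-defines : ∀ k → Defines G (φ k) (π k)) where

  private
    C = Carrier G

  tuple : C → Vec C R
  tuple x = tabulate λ k → π k x

  module _ {ρ : Vec C m} where

    Sat-CoordEq : ∀ i j a b → Sat G ρ (CoordEq φ i j a b) ⇔ (π i (lookup ρ a) ≡ π j (lookup ρ b))
    Sat-CoordEq i j a b = mk⇔
      (λ (z , hi , hj) → trans (sym (to (holds i a) hi)) (to (holds j b) hj))
      (λ e → π i (lookup ρ a) , from (holds i a) refl , from (holds j b) e)
      where
      holds : ∀ k c {z} → Sat G (z ∷ ρ) (φ k ⟨ suc c , v0 ⟩) ⇔ (z ≡ π k (lookup ρ c))
      holds k c = ⇔.trans (Sat-⟨,⟩ G (φ k) (suc c) v0) (φ-defines k _ _)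

    Sat-SameCoords : ∀ a b → Sat G ρ (SameCoords φ a b) ⇔ (tuple (lookup ρ a) ≡ tuple (lookup ρ b))
    Sat-SameCoords a b = ⇔.trans (Sat-⋀ G _) (⇔.trans (∀-⇔ λ k → Sat-CoordEq k k a b) tabulate-≡⇔)

    Sat-ShiftedCoords : ∀ a b →
      Sat G ρ (ShiftedCoords φ a b) ⇔ ShiftsTo (tuple (lookup ρ a)) (tuple (lookup ρ b))
    Sat-ShiftedCoords a b =
      ⇔.trans (Sat-⋀ G _) (∀-⇔ λ i → ⇔.trans (Sat-⋀ G _) (∀-⇔ λ j →
        ⇔.trans (Sat-⊃ G (toℕ i ℕ.≟ suc (toℕ j)) (CoordEq φ i j a b))
          (→-cong-⇔ ⇔.refl (⇔.trans (Sat-CoordEq i j a b) (lookup-tuple⇔ i j)))))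
      where
      lookup-tuple⇔ : ∀ {x y} i j → (π i x ≡ π j y) ⇔ (lookup (tuple x) i ≡ lookup (tuple y) j)
      lookup-tuple⇔ {x} {y} i j = mk⇔ (subst₂ _≡_ (sym (lookup∘tabulate _ i)) (sym (lookup∘tabulate _ j)))
                                      (subst₂ _≡_ (lookup∘tabulate _ i) (lookup∘tabulate _ j))

  ⊨CoordsDistinct⇔ : G ⊨ CoordsDistinct φ ⇔ (∀ x i j → i ≢ j → π i x ≢ π j x)
  ⊨CoordsDistinct⇔ = ∀-⇔ λ x → let ρ = x ∷ [] in
    ⇔.trans (Sat-⋀ G {ρ = ρ} _) (∀-⇔ λ i → ⇔.trans (Sat-⋀ G {ρ = ρ} _) (∀-⇔ λ j →
      ⇔.trans (Sat-⊃ G {ρ = ρ} (¬? (i ≟ j)) (¬ᶠ CoordEq φ i j v0 v0))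
        (→-cong-⇔ ⇔.refl (⇔.trans (Sat-¬ᶠ G (CoordEq φ i j v0 v0)) (¬-cong-⇔ (Sat-CoordEq i j v0 v0))))))

  ⊨CoordsDetermine⇔ : G ⊨ CoordsDetermine φ ⇔ (∀ x y → tuple x ≡ tuple y → x ≡ y)
  ⊨CoordsDetermine⇔ = ∀-⇔ λ x → ∀-⇔ λ y → →-cong-⇔ (Sat-SameCoords {ρ = y ∷ x ∷ []} v1 v0) ⇔.refl

  ⊨AdjacencyIsShift⇔ : G ⊨ AdjacencyIsShift φ ⇔ (∀ x y → Adj G x y ⇔ ShiftAdj (tuple x) (tuple y))
  ⊨AdjacencyIsShift⇔ = ∀-⇔ λ x → ∀-⇔ λ y → let ρ = y ∷ x ∷ [] in
    ⇔.trans (Sat-⇔ᶠ G {ρ = ρ} (adj v1 v0)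
                     (¬ᶠ SameCoords φ v1 v0 ∧ (ShiftedCoords φ v1 v0 ∨ ShiftedCoords φ v0 v1)))
      (⇔-cong ⇔.refl
        (⇔.trans (Sat-¬ᶠ G {ρ = ρ} (SameCoords φ v1 v0)) (¬-cong-⇔ (Sat-SameCoords v1 v0)) ×-⇔
         (Sat-ShiftedCoords {ρ = ρ} v1 v0 ⊎-⇔ Sat-ShiftedCoords {ρ = ρ} v0 v1)))

  embedding : G ⊨ CoordsDistinct φ → G ⊨ CoordsDetermine φ → G ⊨ AdjacencyIsShift φ →
              EmbedsInSymShift R G C
  embedding distinct determine adjacency = record
    { f         = tuple
    ; distinct  = λ x → tabulate⁺ λ {i} {j} → to ⊨CoordsDistinct⇔ distinct x i j
    ; injective = to ⊨CoordsDetermine⇔ determine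
    ; preserve  = λ x y → to (to ⊨AdjacencyIsShift⇔ adjacency x y)
    ; reflect   = λ x y → from (to ⊨AdjacencyIsShift⇔ adjacency x y)
    }

∃ⁿ : ∀ k → Formula k → Sentence
∃ⁿ zero    φ = φ
∃ⁿ (suc k) φ = ∃ⁿ k (ex φ)

AllDistinct : Formula k
AllDistinct = ⋀ λ i → ⋀ λ j → ¬? (i ≟ j) ⊃ ¬ᶠ eq i j

AtLeast : ℕ → Sentence
AtLeast k = ∃ⁿ k AllDistinct

module _ (G : Graph ℓ) where

  private
    C = Carrier G

  ⊨∃ⁿ⇔ : (φ : Formula k) → G ⊨ ∃ⁿ k φ ⇔ Σ (Vec C k) λ xs → Sat G xs φ
  ⊨∃ⁿ⇔ {zero}  φ = mk⇔ ([] ,_) λ { ([] , s) → s }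
  ⊨∃ⁿ⇔ {suc k} φ = ⇔.trans (⊨∃ⁿ⇔ (ex φ))
    (mk⇔ (λ (xs , a , s) → a ∷ xs , s) λ { (a ∷ xs , s) → xs , a , s })

  Sat-AllDistinct : (xs : Vec C k) → Sat G xs AllDistinct ⇔ (∀ i j → i ≢ j → lookup xs i ≢ lookup xs j)
  Sat-AllDistinct xs =
    ⇔.trans (Sat-⋀ G {ρ = xs} _) (∀-⇔ λ i → ⇔.trans (Sat-⋀ G {ρ = xs} _) (∀-⇔ λ j →
      ⇔.trans (Sat-⊃ G {ρ = xs} (¬? (i ≟ j)) (¬ᶠ eq i j)) (→-cong-⇔ ⇔.refl (Sat-¬ᶠ G {ρ = xs} (eq i j)))))

  ⊨AtLeast⇔ : ∀ k → G ⊨ AtLeast k ⇔ Σ (Fin k → C) (Injective _≡_ _≡_)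
  ⊨AtLeast⇔ k = ⇔.trans (⊨∃ⁿ⇔ AllDistinct) (mk⇔
    (λ (xs , s) → lookup xs , λ {i} {j} → distinct⇒injective {xs = xs} (to (Sat-AllDistinct xs) s i j))
    (λ (g , g-inj) → tabulate g , from (Sat-AllDistinct (tabulate g)) λ i j i≢j e →
       i≢j (g-inj (subst₂ _≡_ (lookup∘tabulate g i) (lookup∘tabulate g j) e))))
    where
    distinct⇒injective : ∀ {xs : Vec C k} {i j} → (i ≢ j → lookup xs i ≢ lookup xs j) →
                lookup xs i ≡ lookup xs j → i ≡ j
    distinct⇒injective {i = i} {j} distinct e with i ≟ j
    ... | yes i≡j = i≡j
    ... | no  i≢j = ⊥-elim (distinct i≢j e)

injections⇒Infinite : ∀ {A : Set ℓ} → (∀ k → Σ (Fin k → A) (Injective _≡_ _≡_)) → Infinite A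
injections⇒Infinite injections n A↔Fin =
  1+n≰n (injective⇒≤ {f = Injection.to (↔⇒↣ A↔Fin) ∘ g} (g-injective ∘ Injection.injective (↔⇒↣ A↔Fin)))
  where
  g = proj₁ (injections (suc n))
  g-injective = proj₂ (injections (suc n))

map-injective : ∀ {A B : Set} {f : A → B} → Injective _≡_ _≡_ f → Injective _≡_ _≡_ (map {n = r} f)
map-injective f-inj {[]}     {[]}     _ = refl
map-injective f-inj {x ∷ xs} {y ∷ ys} e =
  cong₂ _∷_ (f-inj (∷-injectiveˡ e)) (map-injective f-inj (∷-injectiveʳ e))

module _ {A B : Set} {f : A → B} (f-inj : Injective _≡_ _≡_ f) where

  ShiftsTo-map⇔ : {u v : Vec A r} → ShiftsTo (map f u) (map f v) ⇔ ShiftsTo u v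
  ShiftsTo-map⇔ {u = u} {v} = ∀-⇔ λ i → ∀-⇔ λ j → →-cong-⇔ ⇔.refl (mk⇔
    (λ e → f-inj (subst₂ _≡_ (lookup-map i f u) (lookup-map j f v) e))
    (λ e → subst₂ _≡_ (sym (lookup-map i f u)) (sym (lookup-map j f v)) (cong f e)))

  ShiftAdj-map⇔ : {u v : Vec A r} → ShiftAdj (map f u) (map f v) ⇔ ShiftAdj u v
  ShiftAdj-map⇔ {u = u} {v} = ¬-cong-⇔ (mk⇔ (map-injective f-inj) (cong (map f))) ×-⇔
                  (ShiftsTo-map⇔ {u = u} {v} ⊎-⇔ ShiftsTo-map⇔ {u = v} {u})

V : ℕ → Set
V r = Carrier (Sh r)

nth : Vec ℕ r → ℕ → ℕ
nth []       _       = 0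
nth (x ∷ _)  zero    = x
nth (_ ∷ xs) (suc j) = nth xs j

-- Coordinates indexed by ℕ; the value 0 out of range is junk.
infix 30 _!_
_!_ : V r → ℕ → ℕ
x ! j = nth (proj₁ x) j

lookup≡nth : (xs : Vec ℕ r) (i : Fin r) → lookup xs i ≡ nth xs (toℕ i)
lookup≡nth (x ∷ xs) zero    = refl
lookup≡nth (x ∷ xs) (suc i) = lookup≡nth xs i

nth-ext : (xs ys : Vec ℕ r) → (∀ j → j < r → nth xs j ≡ nth ys j) → xs ≡ ys
nth-ext []       []       _ = refl
nth-ext (x ∷ xs) (y ∷ ys) h = cong₂ _∷_ (h 0 (s≤s z≤n)) (nth-ext xs ys λ j j<r → h (suc j) (s≤s j<r))

proj₁-injective : {x y : V r} → proj₁ x ≡ proj₁ y → x ≡ y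
proj₁-injective {x = xs , p} refl = cong (xs ,_) (Linked.irrelevant <-irrelevant p _)

vertex-ext : {x y : V r} → (∀ j → j < r → x ! j ≡ y ! j) → x ≡ y
vertex-ext {x = x} {y} h = proj₁-injective (nth-ext (proj₁ x) (proj₁ y) h)

lookup-distinct : (x : V r) {i j : Fin r} → i ≢ j → lookup (proj₁ x) i ≢ lookup (proj₁ x) j
lookup-distinct (_ , inc) {i} {j} i≢j with Fin.<-cmp i j
... | tri< i<j _ _ = <⇒≢ (lookup⁺ <-trans inc i<j)
... | tri≈ _ i≡j _ = ⊥-elim (i≢j i≡j)
... | tri> _ _ j<i = ≢-sym (<⇒≢ (lookup⁺ <-trans inc j<i))

Increasing : Vec ℕ r → Set
Increasing {r} xs = ∀ j → suc j < r → nth xs j < nth xs (suc j)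

linked⇒increasing : {xs : Vec ℕ r} → Linked _<_ xs → Increasing xs
linked⇒increasing {xs = _ ∷ _ ∷ _} (x<y ∷ _) zero _ = x<y
linked⇒increasing (_ ∷ inc) (suc j) (s≤s sj<r) = linked⇒increasing inc j sj<r
linked⇒increasing [-] _ (s≤s ())

increasing⇒linked : (xs : Vec ℕ r) → Increasing xs → Linked _<_ xs
increasing⇒linked []           _   = []
increasing⇒linked (x ∷ [])     _   = [-]
increasing⇒linked (x ∷ y ∷ xs) inc =
  inc 0 (s≤s (s≤s z≤n)) ∷ increasing⇒linked (y ∷ xs) λ j sj<r → inc (suc j) (s≤s sj<r)

!-< : (x : V r) → suc j < r → x ! j < x ! suc j
!-< x = linked⇒increasing (proj₂ x) _

!-+ : (x : V r) → i + j < r → x ! i + j ≤ x ! (i + j)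
!-+ {i = i} {zero} x _ rewrite +-identityʳ i | +-identityʳ (x ! i) = ≤-refl
!-+ {i = i} {suc j} x i+1+j<r rewrite +-suc i j | +-suc (x ! i) j =
  ≤-trans (s≤s (!-+ x (<-trans (n<1+n _) i+1+j<r))) (!-< x i+1+j<r)

tabulateℕ : (r : ℕ) → (ℕ → ℕ) → Vec ℕ r
tabulateℕ zero    g = []
tabulateℕ (suc r) g = g 0 ∷ tabulateℕ r (g ∘ suc)

nth-tabulateℕ : ∀ r g {j} → j < r → nth (tabulateℕ r g) j ≡ g j
nth-tabulateℕ (suc r) g {zero}  _          = refl
nth-tabulateℕ (suc r) g {suc j} (s≤s j<r)  = nth-tabulateℕ r (g ∘ suc) j<r

vertex : (g : ℕ → ℕ) → (∀ j → suc j < r → g j < g (suc j)) → V r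
vertex {r} g g-< = tabulateℕ r g , increasing⇒linked _ λ j sj<r →
  subst₂ _<_ (sym (nth-tabulateℕ r g (<⇒≤ sj<r))) (sym (nth-tabulateℕ r g sj<r)) (g-< j sj<r)

infix 4 _⇝[_]_ _⇝_

-- a is s shifted k places to the left; s ⇝[ 1 ] t is the directed edge s → t of Sh_r(ω).
record _⇝[_]_ (s : V r) (k : ℕ) (a : V r) : Set where
  constructor agreeing
  field
    agree : ∀ j → k + j < r → s ! (k + j) ≡ a ! j

open _⇝[_]_ public

_⇝_ : V r → V r → Set
s ⇝ t = s ⇝[ 1 ] t

ShiftsTo⇔⇝ : {s t : V r} → ShiftsTo (proj₁ s) (proj₁ t) ⇔ s ⇝ t
ShiftsTo⇔⇝ {r} {s} {t} = mk⇔
  (λ h → agreeing λ j sj<r → let j<r = <⇒≤ sj<r in begin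
    s ! suc j                               ≡⟨ cong (s !_) (sym (toℕ-fromℕ< sj<r)) ⟩
    nth (proj₁ s) (toℕ (fromℕ< sj<r))      ≡⟨ sym (lookup≡nth (proj₁ s) _) ⟩
    lookup (proj₁ s) (fromℕ< sj<r)
      ≡⟨ h _ _ (trans (toℕ-fromℕ< sj<r) (cong suc (sym (toℕ-fromℕ< j<r)))) ⟩
    lookup (proj₁ t) (fromℕ< j<r)          ≡⟨ lookup≡nth (proj₁ t) _ ⟩
    nth (proj₁ t) (toℕ (fromℕ< j<r))       ≡⟨ cong (t !_) (toℕ-fromℕ< j<r) ⟩
    t ! j                                   ∎)
  (λ h i j i≡1+j → begin
    lookup (proj₁ s) i   ≡⟨ lookup≡nth (proj₁ s) i ⟩
    s ! toℕ i            ≡⟨ cong (s !_) i≡1+j ⟩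
    s ! suc (toℕ j)      ≡⟨ agree h (toℕ j) (subst (_< r) i≡1+j (toℕ<n i)) ⟩
    t ! toℕ j            ≡⟨ lookup≡nth (proj₁ t) j ⟨
    lookup (proj₁ t) j   ∎)
  where open ≡-Reasoning

⇝[]-⇝ : {s b a : V r} → s ⇝[ k ] b → b ⇝ a → s ⇝[ suc k ] a
⇝[]-⇝ {r} {k} {s} s⇝b b⇝a = agreeing λ j 1+k+j<r →
  let k+1+j<r = subst (_< r) (sym (+-suc k j)) 1+k+j<r in begin
    s ! suc (k + j)  ≡⟨ cong (s !_) (sym (+-suc k j)) ⟩
    s ! (k + suc j)  ≡⟨ agree s⇝b (suc j) k+1+j<r ⟩
    _                ≡⟨ agree b⇝a j (≤-<-trans (m≤n+m (suc j) k) k+1+j<r) ⟩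
    _                ∎
  where open ≡-Reasoning

⇝[]-head : {s a : V r} → s ⇝[ k ] a → k < r → s ! k ≡ a ! 0
⇝[]-head {r} {k} {s} s⇝a k<r = trans (cong (s !_) (sym (+-identityʳ k)))
                                     (agree s⇝a 0 (subst (_< r) (sym (+-identityʳ k)) k<r))

!-consecutive : ∀ (x : V r) {c m} → c ≤ x ! 0 → x ! m ≤ c + m → m < r → j ≤ m → x ! j ≡ c + j
!-consecutive {r} {j} x {c} {m} c≤x₀ xₘ≤c+m m<r j≤m = ≤-antisym upper-bound lower-bound
  where
  open ≤-Reasoning
  j+[m∸j]≡m = m+[n∸m]≡n j≤m
  lower-bound : c + j ≤ x ! j
  lower-bound = ≤-trans (+-monoˡ-≤ j c≤x₀) (!-+ {i = 0} x (≤-<-trans j≤m m<r))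
  upper-bound : x ! j ≤ c + j
  upper-bound = +-cancelʳ-≤ (m ∸ j) (x ! j) (c + j) (begin
    x ! j + (m ∸ j)       ≤⟨ !-+ x (subst (_< r) (sym j+[m∸j]≡m) m<r) ⟩
    x ! (j + (m ∸ j))     ≡⟨ cong (x !_) j+[m∸j]≡m ⟩
    x ! m                 ≤⟨ xₘ≤c+m ⟩
    c + m                 ≡⟨ cong (c +_) j+[m∸j]≡m ⟨
    c + (j + (m ∸ j))     ≡⟨ +-assoc c j (m ∸ j) ⟨
    c + j + (m ∸ j)       ∎)

-- Definability in Sh_(n+2)(ω)

module ShiftGraph (n : ℕ) where

  R : ℕ
  R = suc (suc n)

  infix 4 _~_
  _~_ : V R → V R → Set
  _~_ = Adj (Sh R)

  0<R : 0 < R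
  0<R = z<s

  1<R : 1 < R
  1<R = s<s z<s

  private
    cycle : ∀ {a} {A : Set a} {x} → x < x → A
    cycle x<x = ⊥-elim (<-irrefl refl x<x)

  ⇝-head : {s t : V R} → s ⇝ t → s ! 1 ≡ t ! 0
  ⇝-head s⇝t = agree s⇝t 0 1<R

  ⇝-increases-min : {s t : V R} → s ⇝ t → s ! 0 < t ! 0
  ⇝-increases-min {s} s⇝t = subst (s ! 0 <_) (⇝-head s⇝t) (!-< s 1<R)

  ⇝⇒≢ : {s t : V R} → s ⇝ t → s ≢ t
  ⇝⇒≢ s⇝t refl = cycle (⇝-increases-min s⇝t)

  ~⇔⇝ : {s t : V R} → s ~ t ⇔ (s ⇝ t ⊎ t ⇝ s)
  ~⇔⇝ {s} {t} = mk⇔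
    (λ { (_ , inj₁ h) → inj₁ (to (ShiftsTo⇔⇝ {s = s}) h)
       ; (_ , inj₂ h) → inj₂ (to (ShiftsTo⇔⇝ {s = t}) h) })
    (λ { (inj₁ h) → (⇝⇒≢ h ∘ proj₁-injective) , inj₁ (from (ShiftsTo⇔⇝ {s = s}) h)
       ; (inj₂ h) → (⇝⇒≢ h ∘ sym ∘ proj₁-injective) , inj₂ (from (ShiftsTo⇔⇝ {s = t}) h) })

  ⇝-same-target : {u s t : V R} → u ⇝ t → s ⇝ t → u ! 0 ≡ s ! 0 → u ≡ s
  ⇝-same-target u⇝t s⇝t e = vertex-ext λ
    { zero    _     → e
    ; (suc j) 1+j<R → trans (agree u⇝t j 1+j<R) (sym (agree s⇝t j 1+j<R)) }

  ⇝-same-source : {t u s : V R} → t ⇝ u → t ⇝ s → u ! suc n ≡ s ! suc n → u ≡ s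
  ⇝-same-source t⇝u t⇝s e = vertex-ext λ j j<R → case m≤n⇒m<n∨m≡n (≤-pred j<R) of λ
    { (inj₁ 1+j<R) → trans (sym (agree t⇝u j (s≤s 1+j<R))) (agree t⇝s j (s≤s 1+j<R))
    ; (inj₂ refl)  → e }

  OtherCommonNbr : V R → V R → V R → Set
  OtherCommonNbr s t t′ = ∃ λ u → u ≢ s × u ~ t × u ~ t′

  commonNbr-of-predecessor-successor : {t s t′ u : V R} → t ⇝ s → s ⇝ t′ → u ~ t → u ~ t′ → u ≡ s
  commonNbr-of-predecessor-successor {t} {s} {t′} {u} t⇝s s⇝t′ u~t u~t′
    with to (~⇔⇝ {u} {t}) u~t | to (~⇔⇝ {u} {t′}) u~t′
  ... | inj₂ t⇝u | inj₁ u⇝t′ = ⇝-same-source t⇝u t⇝s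
    (trans (agree u⇝t′ n ≤-refl) (sym (agree s⇝t′ n ≤-refl)))
  ... | inj₂ t⇝u | inj₂ t′⇝u = cycle (begin-strict
    s ! 0  <⟨ ⇝-increases-min s⇝t′ ⟩
    t′ ! 0 <⟨ ⇝-increases-min t′⇝u ⟩
    u ! 0  ≡⟨ trans (sym (⇝-head t⇝u)) (⇝-head t⇝s) ⟩
    s ! 0  ∎)
    where open ≤-Reasoning
  ... | inj₁ u⇝t | inj₁ u⇝t′ = cycle (begin-strict
    t ! 0  <⟨ ⇝-increases-min t⇝s ⟩
    s ! 0  <⟨ ⇝-increases-min s⇝t′ ⟩
    t′ ! 0 ≡⟨ trans (sym (⇝-head u⇝t′)) (⇝-head u⇝t) ⟩
    t ! 0  ∎)
    where open ≤-Reasoning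
  ... | inj₁ u⇝t | inj₂ t′⇝u = cycle (begin-strict
    u ! 0  <⟨ ⇝-increases-min u⇝t ⟩
    t ! 0  <⟨ ⇝-increases-min t⇝s ⟩
    s ! 0  <⟨ ⇝-increases-min s⇝t′ ⟩
    t′ ! 0 <⟨ ⇝-increases-min t′⇝u ⟩
    u ! 0  ∎)
    where open ≤-Reasoning

  commonNbr-of-successors : {s t t′ u : V R} → s ⇝ t → s ⇝ t′ → s ! 1 ≤ 1 → t ≢ t′ →
                         u ~ t → u ~ t′ → u ≡ s
  commonNbr-of-successors {s} {t} {t′} {u} s⇝t s⇝t′ s₁≤1 t≢t′ u~t u~t′
    with to (~⇔⇝ {u} {t}) u~t | to (~⇔⇝ {u} {t′}) u~t′
  ... | inj₁ u⇝t | inj₁ _ =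
    ⇝-same-target u⇝t s⇝t (trans (min≡0 u (trans (⇝-head u⇝t) (sym (⇝-head s⇝t)))) (sym (min≡0 s refl)))
    where
    min≡0 : ∀ x → x ! 1 ≡ s ! 1 → x ! 0 ≡ 0
    min≡0 x e = n<1⇒n≡0 (<-≤-trans (subst (x ! 0 <_) e (!-< x 1<R)) s₁≤1)
  ... | inj₂ t⇝u | inj₂ t′⇝u =
    ⊥-elim (t≢t′ (⇝-same-target t⇝u t′⇝u (trans (sym (⇝-head s⇝t)) (⇝-head s⇝t′))))
  ... | inj₁ u⇝t | inj₂ t′⇝u = cycle (begin-strict
    t′ ! 0 <⟨ ⇝-increases-min t′⇝u ⟩
    u ! 0  <⟨ ⇝-increases-min u⇝t ⟩
    t ! 0  ≡⟨ trans (sym (⇝-head s⇝t)) (⇝-head s⇝t′) ⟩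
    t′ ! 0 ∎)
    where open ≤-Reasoning
  ... | inj₂ t⇝u | inj₁ u⇝t′ = cycle (begin-strict
    t ! 0  <⟨ ⇝-increases-min t⇝u ⟩
    u ! 0  <⟨ ⇝-increases-min u⇝t′ ⟩
    t′ ! 0 ≡⟨ trans (sym (⇝-head s⇝t′)) (⇝-head s⇝t) ⟩
    t ! 0  ∎)
    where open ≤-Reasoning

  private
    c∷ : ℕ → V R → ℕ → ℕ
    c∷ c a zero    = c
    c∷ c a (suc j) = a ! j

  prepend : (c : ℕ) (a : V R) → c < a ! 0 → V R
  prepend c a c<a₀ = vertex (c∷ c a) λ { zero _ → c<a₀ ; (suc j) 2+j<R → !-< a (<⇒≤ 2+j<R) }

  prepend-! : ∀ c a (c<a₀ : c < a ! 0) → prepend c a c<a₀ ! 0 ≡ c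
  prepend-! c a c<a₀ = nth-tabulateℕ R (c∷ c a) 0<R

  prepend-⇝ : ∀ c a (c<a₀ : c < a ! 0) → prepend c a c<a₀ ⇝ a
  prepend-⇝ c a c<a₀ = agreeing λ j 1+j<R → nth-tabulateℕ R (c∷ c a) 1+j<R

  extend : Vec ℕ (suc r) → ℕ → ℕ → ℕ
  extend (x ∷ _)      b zero    = x
  extend (x ∷ [])     b (suc m) = suc (m + b + x)
  extend (x ∷ y ∷ xs) b (suc m) = extend (y ∷ xs) b m

  extend-nth : ∀ (xs : Vec ℕ (suc r)) b {j} → j < suc r → extend xs b j ≡ nth xs j
  extend-nth (x ∷ _)      b {zero}  _           = refl
  extend-nth (x ∷ [])     b {suc j} (s≤s ())
  extend-nth (x ∷ y ∷ xs) b {suc j} (s≤s j<1+r) = extend-nth (y ∷ xs) b j<1+r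

  extend-top : ∀ (xs : Vec ℕ (suc r)) b → extend xs b (suc r) ≡ suc (b + nth xs r)
  extend-top (x ∷ [])     b = refl
  extend-top (x ∷ y ∷ xs) b = extend-top (y ∷ xs) b

  extend-< : ∀ {xs : Vec ℕ (suc r)} b → Linked _<_ xs → ∀ m → extend xs b m < extend xs b (suc m)
  extend-< {xs = x ∷ []}     b _           zero    = s≤s (m≤n+m x b)
  extend-< {xs = x ∷ []}     b _           (suc m) = n<1+n _
  extend-< {xs = x ∷ y ∷ xs} b (x<y ∷ _)   zero    = x<y
  extend-< {xs = x ∷ y ∷ xs} b (_ ∷ inc)   (suc m) = extend-< b inc m

  shift : ℕ → ℕ → V R → V R
  shift b k x = vertex (λ j → extend (proj₁ x) b (k + j)) λ j _ →
    subst (extend (proj₁ x) b (k + j) <_) (cong (extend (proj₁ x) b) (sym (+-suc k j)))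
          (extend-< b (proj₂ x) (k + j))

  ⇝shift : ∀ b k x → x ⇝[ k ] shift b k x
  ⇝shift b k x = agreeing λ j k+j<R →
    trans (sym (extend-nth (proj₁ x) b k+j<R))
          (sym (nth-tabulateℕ R (λ j → extend (proj₁ x) b (k + j)) (≤-<-trans (m≤n+m j k) k+j<R)))

  shift-top : ∀ b x → shift b 1 x ! suc n ≡ suc (b + x ! suc n)
  shift-top b x =
    trans (nth-tabulateℕ R (λ j → extend (proj₁ x) b (1 + j)) ≤-refl) (extend-top (proj₁ x) b)

  ~-sym : {s t : V R} → s ~ t → t ~ s
  ~-sym {s} {t} s~t = from (~⇔⇝ {t} {s}) (swap (to (~⇔⇝ {s} {t}) s~t))

  min≡0⇒⇝ : {w x : V R} → w ! 0 ≡ 0 → w ~ x → w ⇝ x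
  min≡0⇒⇝ {w} {x} w₀≡0 w~x with to (~⇔⇝ {w} {x}) w~x
  ... | inj₁ w⇝x = w⇝x
  ... | inj₂ x⇝w = ⊥-elim (n≮0 (subst (x ! 0 <_) w₀≡0 (⇝-increases-min x⇝w)))

  predecessors-otherCommonNbr : {t t′ s : V R} → t ⇝ s → t′ ⇝ s → OtherCommonNbr s t t′
  predecessors-otherCommonNbr {t} {t′} {s} t⇝s t′⇝s =
    u , u≢s , from ~⇔⇝ (inj₂ t⇝u) , from ~⇔⇝ (inj₂ t′⇝u)
    where
    u : V R
    u = shift (s ! suc n) 1 t
    t⇝u : t ⇝ u
    t⇝u = ⇝shift _ 1 t
    t′⇝u : t′ ⇝ u
    t′⇝u = agreeing λ j 1+j<R →
      trans (agree t′⇝s j 1+j<R) (trans (sym (agree t⇝s j 1+j<R)) (agree t⇝u j 1+j<R))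
    u≢s : u ≢ s
    u≢s u≡s = cycle (begin-strict
      s ! suc n                    <⟨ s≤s (m≤m+n _ _) ⟩
      suc (s ! suc n + t ! suc n)  ≡⟨ shift-top _ t ⟨
      u ! suc n                    ≡⟨ cong (_! suc n) u≡s ⟩
      s ! suc n                    ∎)
      where open ≤-Reasoning

  successors-otherCommonNbr : {s t t′ : V R} → s ⇝ t → s ⇝ t′ → 2 ≤ s ! 1 → OtherCommonNbr s t t′
  successors-otherCommonNbr {s} {t} {t′} s⇝t s⇝t′ 2≤s₁ =
    u , u≢s , from ~⇔⇝ (inj₁ u⇝t) , from ~⇔⇝ (inj₁ u⇝t′)
    where
    c : ℕ
    c = 1 ∸ s ! 0
    c<t₀ : c < t ! 0
    c<t₀ = subst (c <_) (⇝-head s⇝t) (<-≤-trans (s≤s (m∸n≤m 1 (s ! 0))) 2≤s₁)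
    u : V R
    u = prepend c t c<t₀
    u⇝t : u ⇝ t
    u⇝t = prepend-⇝ c t c<t₀
    u⇝t′ : u ⇝ t′
    u⇝t′ = agreeing λ j 1+j<R →
      trans (agree u⇝t j 1+j<R) (trans (sym (agree s⇝t j 1+j<R)) (agree s⇝t′ j 1+j<R))
    1∸x≢x : ∀ x → 1 ∸ x ≢ x
    1∸x≢x zero ()
    1∸x≢x (suc zero) ()
    1∸x≢x (suc (suc x)) ()
    u≢s : u ≢ s
    u≢s u≡s = 1∸x≢x (s ! 0) (trans (sym (prepend-! c t c<t₀)) (cong (_! 0) u≡s))

  -- Two distinct successors of w have a common neighbour other than w iff w ! 1 ≥ 2, a predecessor and a
  -- successor never do; so this mixed configuration exists iff w has a predecessor, i.e. w ! 0 ≢ 0.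
  ZeroWitness : V R → Set
  ZeroWitness w = Σ (V R) λ t → Σ (V R) λ t′ → Σ (V R) λ t″ →
    w ~ t × w ~ t′ × w ~ t″ × t ≢ t′ × t ≢ t″ × ¬ OtherCommonNbr w t t′ × OtherCommonNbr w t t″

  min≢0⇒zeroWitness : {w : V R} → w ! 0 ≢ 0 → ZeroWitness w
  min≢0⇒zeroWitness {w} w₀≢0 =
    t , t′ , t″ , from ~⇔⇝ (inj₁ w⇝t) , from ~⇔⇝ (inj₂ t′⇝w) , from ~⇔⇝ (inj₁ w⇝t″) ,
    t≢t′ , t≢t″ , no-other , successors-otherCommonNbr w⇝t w⇝t″ 2≤w₁
    where
    0<w₀ : 0 < w ! 0
    0<w₀ = n≢0⇒n>0 w₀≢0
    t t′ t″ : V R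
    t  = shift 0 1 w
    t′ = prepend 0 w 0<w₀
    t″ = shift 1 1 w
    w⇝t : w ⇝ t
    w⇝t = ⇝shift 0 1 w
    t′⇝w : t′ ⇝ w
    t′⇝w = prepend-⇝ 0 w 0<w₀
    w⇝t″ : w ⇝ t″
    w⇝t″ = ⇝shift 1 1 w
    2≤w₁ : 2 ≤ w ! 1
    2≤w₁ = <-≤-trans (s≤s 0<w₀) (!-< w 1<R)
    t≢t′ : t ≢ t′
    t≢t′ t≡t′ = <⇒≢ (<-≤-trans z<s 2≤w₁)
      (sym (trans (⇝-head w⇝t) (trans (cong (_! 0) t≡t′) (prepend-! 0 w 0<w₀))))
    t≢t″ : t ≢ t″
    t≢t″ t≡t″ = 1+n≢n (sym (suc-injective
      (trans (sym (shift-top 0 w)) (trans (cong (_! suc n) t≡t″) (shift-top 1 w)))))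
    no-other : ¬ OtherCommonNbr w t t′
    no-other (u , u≢w , u~t , u~t′) = u≢w (commonNbr-of-predecessor-successor t′⇝w w⇝t u~t′ u~t)

  min≡0⇒¬zeroWitness : {w : V R} → w ! 0 ≡ 0 → ¬ ZeroWitness w
  min≡0⇒¬zeroWitness {w} w₀≡0
    (t , t′ , t″ , w~t , w~t′ , w~t″ , t≢t′ , t≢t″ , no-other , (u , u≢w , u~t , u~t″))
    with 2 ≤? w ! 1
  ... | yes 2≤w₁ =
    no-other (successors-otherCommonNbr (min≡0⇒⇝ {w} {t} w₀≡0 w~t) (min≡0⇒⇝ {w} {t′} w₀≡0 w~t′) 2≤w₁)
  ... | no  2≰w₁ = u≢w (commonNbr-of-successors (min≡0⇒⇝ {w} {t} w₀≡0 w~t) (min≡0⇒⇝ {w} {t″} w₀≡0 w~t″)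
                          (≤-pred (≰⇒> 2≰w₁)) t≢t″ u~t u~t″)

  -- A neighbour t of s is a predecessor iff some neighbour w of s with w ! 0 ≡ 0 is t or has a
  -- common neighbour with t other than s; this makes the direction of edges definable.
  BadZeroNbr : V R → V R → Set
  BadZeroNbr s t = ∃ λ w → s ~ w × w ! 0 ≡ 0 × (w ≡ t ⊎ OtherCommonNbr s w t)

  ⇝⇒¬badZeroNbr : {s t : V R} → s ⇝ t → ¬ BadZeroNbr s t
  ⇝⇒¬badZeroNbr s⇝t (w , s~w , w₀≡0 , inj₁ refl) =
    n≮0 (subst (_ <_) w₀≡0 (≤-<-trans z≤n (⇝-increases-min s⇝t)))
  ⇝⇒¬badZeroNbr {s} s⇝t (w , s~w , w₀≡0 , inj₂ (u , u≢s , u~w , u~t)) =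
    u≢s (commonNbr-of-predecessor-successor (min≡0⇒⇝ {w} {s} w₀≡0 (~-sym {s} {w} s~w)) s⇝t u~w u~t)

  ¬badZeroNbr⇒⇝ : {s t : V R} → s ~ t → ¬ BadZeroNbr s t → s ⇝ t
  ¬badZeroNbr⇒⇝ {s} {t} s~t no-bad with to (~⇔⇝ {s} {t}) s~t
  ... | inj₁ s⇝t = s⇝t
  ... | inj₂ t⇝s = ⊥-elim (no-bad
    (w , from ~⇔⇝ (inj₂ w⇝s) , prepend-! 0 s 0<s₀ , inj₂ (predecessors-otherCommonNbr w⇝s t⇝s)))
    where
    0<s₀ : 0 < s ! 0
    0<s₀ = ≤-<-trans z≤n (⇝-increases-min t⇝s)
    w : V R
    w = prepend 0 s 0<s₀
    w⇝s : w ⇝ s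
    w⇝s = prepend-⇝ 0 s 0<s₀

  CommonNbr : Fin m → Fin m → Fin m → Formula m
  CommonNbr s t t′ = ex (¬ᶠ eq v0 (suc s) ∧ (adj v0 (suc t) ∧ adj v0 (suc t′)))

  Sat-CommonNbr : (ρ : Vec (V R) m) → ∀ s t t′ →
    Sat (Sh R) ρ (CommonNbr s t t′) ⇔ OtherCommonNbr (lookup ρ s) (lookup ρ t) (lookup ρ t′)
  Sat-CommonNbr ρ s t t′ = mk⇔ (λ (u , u≢s , adjs) → u , lower ∘ u≢s , adjs)
                               (λ (u , u≢s , adjs) → u , lift ∘ u≢s , adjs)

  ZeroWitnessF : Fin m → Formula m
  ZeroWitnessF w = ex (ex (ex (adj w′ v2 ∧ (adj w′ v1 ∧ (adj w′ v0 ∧ (¬ᶠ eq v2 v1 ∧ (¬ᶠ eq v2 v0 ∧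
                     (¬ᶠ CommonNbr w′ v2 v1 ∧ CommonNbr w′ v2 v0))))))))
    where
    w′ = suc (suc (suc w))

  Sat-ZeroWitnessF : (ρ : Vec (V R) m) → ∀ w → Sat (Sh R) ρ (ZeroWitnessF w) ⇔ ZeroWitness (lookup ρ w)
  Sat-ZeroWitnessF ρ w = mk⇔
    (λ (t , t′ , t″ , w~t , w~t′ , w~t″ , t≢t′ , t≢t″ , no-other , other) →
      let ρ′ = t″ ∷ t′ ∷ t ∷ ρ ; w′ = suc (suc (suc w)) in
      t , t′ , t″ , w~t , w~t′ , w~t″ , lower ∘ t≢t′ , lower ∘ t≢t″ ,
      lower ∘ no-other ∘ from (Sat-CommonNbr ρ′ w′ v2 v1) , to (Sat-CommonNbr ρ′ w′ v2 v0) other)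
    (λ (t , t′ , t″ , w~t , w~t′ , w~t″ , t≢t′ , t≢t″ , no-other , other) →
      let ρ′ = t″ ∷ t′ ∷ t ∷ ρ ; w′ = suc (suc (suc w)) in
      t , t′ , t″ , w~t , w~t′ , w~t″ , lift ∘ t≢t′ , lift ∘ t≢t″ ,
      lift ∘ no-other ∘ to (Sat-CommonNbr ρ′ w′ v2 v1) , from (Sat-CommonNbr ρ′ w′ v2 v0) other)

  MinZero : Fin m → Formula m
  MinZero w = ¬ᶠ ZeroWitnessF w

  Sat-MinZero : (ρ : Vec (V R) m) → ∀ w → Sat (Sh R) ρ (MinZero w) ⇔ (lookup ρ w ! 0 ≡ 0)
  Sat-MinZero ρ w = mk⇔
    (λ no-witness → case lookup ρ w ! 0 ℕ.≟ 0 of λ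
      { (yes w₀≡0) → w₀≡0
      ; (no w₀≢0)  → ⊥-elim (lower (no-witness (from (Sat-ZeroWitnessF ρ w) (min≢0⇒zeroWitness w₀≢0)))) })
    (λ w₀≡0 → lift ∘ min≡0⇒¬zeroWitness w₀≡0 ∘ to (Sat-ZeroWitnessF ρ w))

  BadZeroNbrF : Fin m → Fin m → Formula m
  BadZeroNbrF s t = ex (adj (suc s) v0 ∧ (MinZero v0 ∧ (eq v0 (suc t) ∨ CommonNbr (suc s) v0 (suc t))))

  Sat-BadZeroNbrF : (ρ : Vec (V R) m) → ∀ s t →
    Sat (Sh R) ρ (BadZeroNbrF s t) ⇔ BadZeroNbr (lookup ρ s) (lookup ρ t)
  Sat-BadZeroNbrF ρ s t = mk⇔
    (λ (w , s~w , w-min , w-rel) → w , s~w , to (Sat-MinZero (w ∷ ρ) v0) w-min ,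
       map₂ (to (Sat-CommonNbr (w ∷ ρ) (suc s) v0 (suc t))) w-rel)
    (λ (w , s~w , w₀≡0 , w-rel) → w , s~w , from (Sat-MinZero (w ∷ ρ) v0) w₀≡0 ,
       map₂ (from (Sat-CommonNbr (w ∷ ρ) (suc s) v0 (suc t))) w-rel)

  Succ : Fin m → Fin m → Formula m
  Succ s t = adj s t ∧ ¬ᶠ BadZeroNbrF s t

  Sat-Succ : (ρ : Vec (V R) m) → ∀ s t → Sat (Sh R) ρ (Succ s t) ⇔ (lookup ρ s ⇝ lookup ρ t)
  Sat-Succ ρ s t = mk⇔
    (λ (s~t , no-bad) → ¬badZeroNbr⇒⇝ s~t (lower ∘ no-bad ∘ from (Sat-BadZeroNbrF ρ s t)))
    (λ s⇝t → from ~⇔⇝ (inj₁ s⇝t) , lift ∘ ⇝⇒¬badZeroNbr s⇝t ∘ to (Sat-BadZeroNbrF ρ s t))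

  Shift : ℕ → Fin m → Fin m → Formula m
  Shift zero    s a = eq s a
  Shift (suc k) s a = ex (Shift k (suc s) v0 ∧ Succ v0 (suc a))

  Sat-Shift : (ρ : Vec (V R) m) → ∀ {k} s a → k < R →
              Sat (Sh R) ρ (Shift k s a) ⇔ (lookup ρ s ⇝[ k ] lookup ρ a)
  Sat-Shift ρ {zero} s a _ = mk⇔ (λ e → agreeing λ j _ → cong (_! j) e) (λ h → vertex-ext (agree h))
  Sat-Shift ρ {suc k} s a 1+k<R = mk⇔
    (λ (b , s⇝b , b⇝a) →
      ⇝[]-⇝ (to (Sat-Shift (b ∷ ρ) (suc s) v0 k<R) s⇝b) (to (Sat-Succ (b ∷ ρ) v0 (suc a)) b⇝a))
    (λ s⇝a → let S = lookup ρ s ; A = lookup ρ a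
                 Sₖ<A₀ = subst (S ! k <_) (⇝[]-head s⇝a 1+k<R) (!-< S 1+k<R)
                 b = prepend (S ! k) A Sₖ<A₀ in
      b , from (Sat-Shift (b ∷ ρ) (suc s) v0 k<R) (⇝prepend s⇝a Sₖ<A₀)
        , from (Sat-Succ (b ∷ ρ) v0 (suc a)) (prepend-⇝ (S ! k) A Sₖ<A₀))
    where
    k<R = <⇒≤ 1+k<R
    ⇝prepend : {S A : V R} (S⇝A : S ⇝[ suc k ] A) (Sₖ<A₀ : S ! k < A ! 0) → S ⇝[ k ] prepend (S ! k) A Sₖ<A₀
    ⇝prepend {S} {A} S⇝A Sₖ<A₀ = agreeing λ
      { zero    _       → trans (cong (S !_) (+-identityʳ k)) (sym (prepend-! _ A Sₖ<A₀))
      ; (suc j) k+1+j<R → let 1+k+j<R = subst (_< R) (+-suc k j) k+1+j<R in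
          trans (cong (S !_) (+-suc k j))
                (trans (agree S⇝A j 1+k+j<R)
                       (sym (agree (prepend-⇝ _ A Sₖ<A₀) j (≤-<-trans (s≤s (m≤n+m j k)) 1+k+j<R)))) }

  MinAtLeast : ℕ → Fin m → Formula m
  MinAtLeast zero    a = ⊤ᶠ
  MinAtLeast (suc k) a = ex (Succ v0 (suc a) ∧ MinAtLeast k v0)

  Sat-MinAtLeast : (ρ : Vec (V R) m) → ∀ k a → Sat (Sh R) ρ (MinAtLeast k a) ⇔ (k ≤ lookup ρ a ! 0)
  Sat-MinAtLeast ρ zero    a = mk⇔ (λ _ → z≤n) (λ _ x → x)
  Sat-MinAtLeast ρ (suc k) a = mk⇔
    (λ (z , z⇝a , k≤z₀) → ≤-<-trans (to (Sat-MinAtLeast (z ∷ ρ) k v0) k≤z₀)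
                                     (⇝-increases-min (to (Sat-Succ (z ∷ ρ) v0 (suc a)) z⇝a)))
    (λ k<A₀ → let z = prepend k (lookup ρ a) k<A₀ in
      z , from (Sat-Succ (z ∷ ρ) v0 (suc a)) (prepend-⇝ k _ k<A₀)
        , from (Sat-MinAtLeast (z ∷ ρ) k v0) (≤-reflexive (sym (prepend-! k (lookup ρ a) k<A₀))))

  MinIs : ℕ → Fin m → Formula m
  MinIs p a = MinAtLeast p a ∧ ¬ᶠ MinAtLeast (suc p) a

  Sat-MinIs : (ρ : Vec (V R) m) → ∀ p a → Sat (Sh R) ρ (MinIs p a) ⇔ (lookup ρ a ! 0 ≡ p)
  Sat-MinIs ρ p a = mk⇔
    (λ (p≤A₀ , A₀≯p) → ≤-antisym (≮⇒≥ (lower ∘ A₀≯p ∘ from (Sat-MinAtLeast ρ (suc p) a)))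
                                 (to (Sat-MinAtLeast ρ p a) p≤A₀))
    (λ A₀≡p → from (Sat-MinAtLeast ρ p a) (≤-reflexive (sym A₀≡p))
            , lift ∘ <-irrefl (sym A₀≡p) ∘ to (Sat-MinAtLeast ρ (suc p) a))

  AtCoord : ℕ → Fin m → Formula (suc m) → Formula m
  AtCoord k x ψ = ex (Shift k (suc x) v0 ∧ ψ)

  Sat-AtCoord : (ρ : Vec (V R) m) → ∀ {k} x ψ (P : ℕ → Set) → k < R →
                (∀ a → Sat (Sh R) (a ∷ ρ) ψ ⇔ P (a ! 0)) →
                Sat (Sh R) ρ (AtCoord k x ψ) ⇔ P (lookup ρ x ! k)
  Sat-AtCoord ρ {k} x ψ P k<R ψ⇔P = mk⇔
    (λ (a , x⇝a , ψa) →
      subst P (sym (⇝[]-head (to (Sat-Shift (a ∷ ρ) (suc x) v0 k<R) x⇝a) k<R)) (to (ψ⇔P a) ψa))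
    (λ Pxₖ → let X = lookup ρ x ; a = shift 0 k X in
      a , from (Sat-Shift (a ∷ ρ) (suc x) v0 k<R) (⇝shift 0 k X)
        , from (ψ⇔P a) (subst P (⇝[]-head (⇝shift 0 k X) k<R) Pxₖ))

  n<R : n < R
  n<R = s≤s (n≤1+n n)

  HasInitialRange : Fin m → Formula m
  HasInitialRange y = ¬ᶠ AtCoord n y (MinAtLeast (suc n) v0)

  Sat-HasInitialRange : (ρ : Vec (V R) m) → ∀ y → Sat (Sh R) ρ (HasInitialRange y) ⇔ (lookup ρ y ! n ≤ n)
  Sat-HasInitialRange ρ y = ⇔.trans (Sat-¬ᶠ (Sh R) (AtCoord n y (MinAtLeast (suc n) v0)))
    (⇔.trans (¬-cong-⇔ (Sat-AtCoord ρ y (MinAtLeast (suc n) v0) (n <_) n<R λ a →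
                     Sat-MinAtLeast (a ∷ ρ) (suc n) v0))
             (mk⇔ ≮⇒≥ ≤⇒≯))

  ⇝[last]⇔ : {y a : V R} → y ⇝[ suc n ] a ⇔ (y ! suc n ≡ a ! 0)
  ⇝[last]⇔ {y} = mk⇔ (λ y⇝a → ⇝[]-head y⇝a ≤-refl) λ e → agreeing λ
    { zero    _ → trans (cong (y !_) (+-identityʳ (suc n))) e
    ; (suc j) p → cycle (<-≤-trans (m<m+n (suc n) z<s) (≤-pred p)) }

  LowCoded : ℕ → V R → Set
  LowCoded q y = (n < q × y ! suc n ≡ q) × y ! n ≤ n

  TightCoded : ℕ → V R → Set
  TightCoded q y = y ! 0 ≡ suc q × y ! suc n ≡ suc q + suc n

  LowCode : ℕ → Fin m → Fin m → Formula m
  LowCode k x y = AtCoord k x (MinAtLeast (suc n) v0 ∧ Shift (suc n) (suc y) v0) ∧ HasInitialRange y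

  Sat-LowCode : (ρ : Vec (V R) m) → ∀ {k} x y → k < R →
    Sat (Sh R) ρ (LowCode k x y) ⇔ LowCoded (lookup ρ x ! k) (lookup ρ y)
  Sat-LowCode ρ x y k<R =
    Sat-AtCoord ρ x (MinAtLeast (suc n) v0 ∧ Shift (suc n) (suc y) v0)
                (λ c → n < c × lookup ρ y ! suc n ≡ c) k<R
                (λ a → Sat-MinAtLeast (a ∷ ρ) (suc n) v0 ×-⇔
                                   ⇔.trans (Sat-Shift (a ∷ ρ) (suc y) v0 ≤-refl) ⇝[last]⇔)
    ×-⇔ Sat-HasInitialRange ρ y

  TightCode : ℕ → ℕ → Fin m → Fin m → Formula m
  TightCode k p x y =
    AtCoord k x (MinIs p v0) ∧ (MinIs (suc p) y ∧ AtCoord (suc n) y (MinIs (suc p + suc n) v0))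

  Sat-TightCode : (ρ : Vec (V R) m) → ∀ {k} p x y → k < R →
    Sat (Sh R) ρ (TightCode k p x y) ⇔ (lookup ρ x ! k ≡ p × TightCoded p (lookup ρ y))
  Sat-TightCode ρ p x y k<R =
    Sat-AtCoord ρ x (MinIs p v0) (_≡ p) k<R (λ a → Sat-MinIs (a ∷ ρ) p v0) ×-⇔
    (Sat-MinIs ρ (suc p) y ×-⇔
     Sat-AtCoord ρ y (MinIs (suc p + suc n) v0) (_≡ suc p + suc n) ≤-refl
                 (λ a → Sat-MinIs (a ∷ ρ) (suc p + suc n) v0))

  tight : ℕ → V R
  tight a = vertex (a +_) λ j _ → +-monoʳ-< a (n<1+n j)

  ≡tight⇔ : ∀ {a y} → y ≡ tight a ⇔ (y ! 0 ≡ a × y ! suc n ≡ a + suc n)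
  ≡tight⇔ {a} {y} = mk⇔
    (λ { refl → trans (nth-tabulateℕ R (a +_) 0<R) (+-identityʳ a) , nth-tabulateℕ R (a +_) ≤-refl })
    (λ (y₀≡a , yₙ₊₁≡a+n+1) → vertex-ext λ j j<R →
      trans (!-consecutive y (≤-reflexive (sym y₀≡a)) (≤-reflexive yₙ₊₁≡a+n+1) ≤-refl (≤-pred j<R))
            (sym (nth-tabulateℕ R (a +_) j<R)))

  private
    lowCoords : ℕ → ℕ → ℕ
    lowCoords q j with j ≤? n
    ... | yes _ = j
    ... | no  _ = q

    lowCoords-≤ : ∀ q {j} → j ≤ n → lowCoords q j ≡ j
    lowCoords-≤ q {j} j≤n with j ≤? n
    ... | yes _   = refl
    ... | no  j≰n = ⊥-elim (j≰n j≤n)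

    lowCoords-top : ∀ q → lowCoords q (suc n) ≡ q
    lowCoords-top q with suc n ≤? n
    ... | yes 1+n≤n = ⊥-elim (1+n≰n 1+n≤n)
    ... | no  _     = refl

  low : (q : ℕ) → n < q → V R
  low q n<q = vertex (lowCoords q) λ j 2+j<R → case m≤n⇒m<n∨m≡n (≤-pred (≤-pred 2+j<R)) of λ
    { (inj₁ j<n) → subst₂ _<_ (sym (lowCoords-≤ q (<⇒≤ j<n))) (sym (lowCoords-≤ q j<n)) ≤-refl
    ; (inj₂ refl) → subst₂ _<_ (sym (lowCoords-≤ q ≤-refl)) (sym (lowCoords-top q)) n<q }

  ≡low⇔ : ∀ {q y} (n<q : n < q) → y ≡ low q n<q ⇔ (y ! suc n ≡ q × y ! n ≤ n)
  ≡low⇔ {q} {y} n<q = mk⇔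
    (λ { refl → trans (nth-tabulateℕ R (lowCoords q) ≤-refl) (lowCoords-top q)
              , ≤-reflexive (trans (nth-tabulateℕ R (lowCoords q) n<R) (lowCoords-≤ q ≤-refl)) })
    (λ (yₙ₊₁≡q , yₙ≤n) → vertex-ext λ j j<R →
      trans (y!j yₙ₊₁≡q yₙ≤n j<R) (sym (nth-tabulateℕ R (lowCoords q) j<R)))
    where
    y!j : y ! suc n ≡ q → y ! n ≤ n → j < R → y ! j ≡ lowCoords q j
    y!j yₙ₊₁≡q yₙ≤n j<R with m≤n⇒m<n∨m≡n (≤-pred j<R)
    ... | inj₁ j<1+n =
      trans (!-consecutive y z≤n yₙ≤n n<R (≤-pred j<1+n)) (sym (lowCoords-≤ q (≤-pred j<1+n)))
    ... | inj₂ refl  = trans yₙ₊₁≡q (sym (lowCoords-top q))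

  -- An injective coding of ℕ by vertices, shaped so that y ≡ code (x ! k) is definable.
  code : ℕ → V R
  code q with q ≤? n
  ... | yes _   = tight (suc q)
  ... | no  q≰n = low q (≰⇒> q≰n)

  ≡code⇔ : ∀ {q y} → y ≡ code q ⇔ (LowCoded q y ⊎ q ≤ n × TightCoded q y)
  ≡code⇔ {q} {y} with q ≤? n
  ... | yes q≤n = mk⇔ (inj₂ ∘ (q≤n ,_) ∘ to ≡tight⇔) λ
    { (inj₁ ((n<q , _) , _)) → ⊥-elim (<⇒≱ n<q q≤n)
    ; (inj₂ (_ , tight))     → from ≡tight⇔ tight }
  ... | no  q≰n = mk⇔
    (λ y≡low → let (yₙ₊₁≡q , yₙ≤n) = to (≡low⇔ n<q) y≡low in inj₁ ((n<q , yₙ₊₁≡q) , yₙ≤n)) λ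
    { (inj₁ ((_ , yₙ₊₁≡q) , yₙ≤n)) → from (≡low⇔ n<q) (yₙ₊₁≡q , yₙ≤n)
    ; (inj₂ (q≤n , _))             → ⊥-elim (q≰n q≤n) }
    where
    n<q = ≰⇒> q≰n

  code-injective : Injective _≡_ _≡_ code
  code-injective {q} {q′} e with to (≡code⇔ {q}) refl | to (≡code⇔ {q′}) e
  ... | inj₁ ((_ , yₙ₊₁≡q) , _) | inj₁ ((_ , yₙ₊₁≡q′) , _) = trans (sym yₙ₊₁≡q) yₙ₊₁≡q′
  ... | inj₂ (_ , y₀≡1+q , _)   | inj₂ (_ , y₀≡1+q′ , _)   = suc-injective (trans (sym y₀≡1+q) y₀≡1+q′)
  ... | inj₁ (_ , yₙ≤n)         | inj₂ (_ , y₀≡1+q′ , _)   =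
    ⊥-elim (0≢1+n (trans (sym (!-consecutive (code q) z≤n yₙ≤n n<R z≤n)) y₀≡1+q′))
  ... | inj₂ (_ , y₀≡1+q , _)   | inj₁ (_ , yₙ≤n)         =
    ⊥-elim (0≢1+n (trans (sym (!-consecutive (code q) z≤n yₙ≤n n<R z≤n)) y₀≡1+q))

  coord : Fin R → Formula 2
  coord k = LowCode (toℕ k) v1 v0 ∨ ⋁ λ (p : Fin (suc n)) → TightCode (toℕ k) (toℕ p) v1 v0

  coord-defines : ∀ k → Defines (Sh R) (coord k) (λ x → code (lookup (proj₁ x) k))
  coord-defines k x y = begin
    Holds (Sh R) (coord k) x y
      ∼⟨ Sat-LowCode ρ v1 v0 (toℕ<n k) ⊎-⇔
         ⇔.trans (Sat-⋁ (Sh R) λ p → TightCode (toℕ k) (toℕ p) v1 v0) tight-case ⟩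
    (LowCoded (x ! toℕ k) y ⊎ x ! toℕ k ≤ n × TightCoded (x ! toℕ k) y)
      ∼⟨ ⇔.sym ≡code⇔ ⟩
    y ≡ code (x ! toℕ k)
      ≡⟨ cong (λ q → y ≡ code q) (sym (lookup≡nth (proj₁ x) k)) ⟩
    y ≡ code (lookup (proj₁ x) k) ∎
    where
    open EquationalReasoning {k = equivalence}
    ρ = y ∷ x ∷ []
    tight-case : (∃ λ (p : Fin (suc n)) → Sat (Sh R) ρ (TightCode (toℕ k) (toℕ p) v1 v0)) ⇔
                 (x ! toℕ k ≤ n × TightCoded (x ! toℕ k) y)
    tight-case = mk⇔
      (λ (p , s) → let (xₖ≡p , rest) = to (Sat-TightCode ρ (toℕ p) v1 v0 (toℕ<n k)) s in
         subst (_≤ n) (sym xₖ≡p) (≤-pred (toℕ<n p)) , subst (λ q → TightCoded q y) (sym xₖ≡p) rest)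
      (λ (xₖ≤n , rest) → fromℕ< (s≤s xₖ≤n) , from (Sat-TightCode ρ _ v1 v0 (toℕ<n k))
         (sym (toℕ-fromℕ< _) , subst (λ q → TightCoded q y) (sym (toℕ-fromℕ< _)) rest))

-- Sh_r(ω) satisfies the coordinate sentences

record CoordinateCode (r : ℕ) : Set where
  field
    code           : ℕ → V r
    code-injective : Injective _≡_ _≡_ code
    coord          : Fin r → Formula 2
    coord-defines  : ∀ k → Defines (Sh r) (coord k) (λ x → code (lookup (proj₁ x) k))

coordinateCode : ∀ r → CoordinateCode (suc r)
coordinateCode zero = record
  { code           = λ q → q ∷ [] , [-]
  ; code-injective = λ { refl → refl }
  ; coord          = λ _ → eq v1 v0
  ; coord-defines  = λ { zero (_ ∷ [] , [-]) y → mk⇔ sym sym }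
  }
coordinateCode (suc n) = record
  { code           = code
  ; code-injective = code-injective
  ; coord          = coord
  ; coord-defines  = coord-defines
  }
  where open ShiftGraph n

module _ (cc : CoordinateCode r) where

  open CoordinateCode cc
  open Coordinates (Sh r) {φ = coord} coord-defines

  tuple≡map : ∀ x → tuple x ≡ map code (proj₁ x)
  tuple≡map x = trans (tabulate-∘ code (lookup (proj₁ x))) (cong (map code) (tabulate∘lookup (proj₁ x)))

  Sh⊨CoordsDistinct : Sh r ⊨ CoordsDistinct coord
  Sh⊨CoordsDistinct = from ⊨CoordsDistinct⇔ λ x i j i≢j → lookup-distinct x i≢j ∘ code-injective

  Sh⊨CoordsDetermine : Sh r ⊨ CoordsDetermine coord
  Sh⊨CoordsDetermine = from ⊨CoordsDetermine⇔ λ x y e →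
    proj₁-injective (map-injective code-injective (trans (sym (tuple≡map x)) (trans e (tuple≡map y))))

  Sh⊨AdjacencyIsShift : Sh r ⊨ AdjacencyIsShift coord
  Sh⊨AdjacencyIsShift = from ⊨AdjacencyIsShift⇔ λ x y →
    subst₂ (λ u v → Adj (Sh r) x y ⇔ ShiftAdj u v) (sym (tuple≡map x)) (sym (tuple≡map y))
           (⇔.sym (ShiftAdj-map⇔ code-injective))

  Sh⊨AtLeast : ∀ k → Sh r ⊨ AtLeast k
  Sh⊨AtLeast k = from (⊨AtLeast⇔ (Sh r) k) (code ∘ toℕ , Fin.toℕ-injective ∘ code-injective)

lemma2p9 : ∀ {ℓ : Level} → ExcludedMiddle ℓ → (r : ℕ) → 1 ≤ r →
    (M : Graph ℓ) → ModelOfTh (Sh r) M →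
    Σ (Set ℓ) λ A → Infinite A × (A ↔ Carrier M) × EmbedsInSymShift r M A
lemma2p9 _ (suc r) _ M M⊨Th = Carrier M , infinite , ↔-refl , embedding
  where
  cc = coordinateCode r
  open CoordinateCode cc

  infinite : Infinite (Carrier M)
  infinite = injections⇒Infinite λ k → to (⊨AtLeast⇔ M k) (M⊨Th (AtLeast k) (Sh⊨AtLeast cc k))

  coordinate : ∀ k → Σ (Carrier M → Carrier M) (Defines M (coord k))
  coordinate k = ⊨IsFunction⇒defines M (coord k)
    (M⊨Th (IsFunction (coord k)) (defines⇒⊨IsFunction (Sh (suc r)) (coord k) (coord-defines k)))

  embedding : EmbedsInSymShift (suc r) M (Carrier M)
  embedding = Coordinates.embedding M {φ = coord} (proj₂ ∘ coordinate)
    (M⊨Th (CoordsDistinct coord) (Sh⊨CoordsDistinct cc))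
    (M⊨Th (CoordsDetermine coord) (Sh⊨CoordsDetermine cc))
    (M⊨Th (AdjacencyIsShift coord) (Sh⊨AdjacencyIsShift cc))
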